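{- Let $\Delta$ be an $i$-banner simplicial complex of dimension $d-1$ on $n$ vertices (with $1\leq i\leq d$). Then $f_{i-1}(\Delta)\leq \binom{n}{i}_d$.
   Context: A simplicial complex $\Delta$ is a family of subsets of a vertex set closed under taking subsets and containing all singletons; $f_j(\Delta)$ is the number of faces of size $j+1$. A clique is a set $T$ of vertices pairwise forming edges; it is critical if $T\setminus\{v\}$ is a face for some $v\in T$; $\Delta$ is $i$-banner if every critical clique of size at least $i+1$ is a face. $\Gamma(n,d)$ denotes the complete multipartite graph on $n$ vertices with $d$ parts, each of size $\lceil n/d\rceil$ or $\lfloor n/d\rfloor$, and $\binom{n}{j}_d$ denotes the number of $j$-element cliques in $\Gamma(n,d)$. -}

module Defs where

open import Data.Bool using (Bool; true; false; T; T?)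
open import Data.Nat using (ℕ; zero; suc; _≤_; _+_; _%_; NonZero)
import Data.Nat as ℕ
open import Data.Fin using (Fin; toℕ)
import Data.Fin as F
open import Data.Fin.Subset using (Subset; _∈_; _⊆_; ⁅_⁆; ∣_∣; _-_)
open import Data.Fin.Subset.Properties using (_∈?_)
open import Data.Fin.Properties using (all?)
open import Data.Vec using ([]; _∷_)
open import Data.List using (List; []; _∷_; map; _++_; filter; length)
open import Data.Product using (_×_; Σ; ∃; _,_)
open import Relation.Nullary using (¬_; Dec; yes; no)
open import Relation.Nullary.Decidable using (_×-dec_; _→-dec_; ¬?)
open import Relation.Binary.PropositionalEquality using (_≡_; _≢_)

allSubsets : (n : ℕ) → List (Subset n)
allSubsets zero = [] ∷ []
allSubsets (suc n) = map (true ∷_) (allSubsets n) ++ map (false ∷_) (allSubsets n)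

record SimplicialComplex (n : ℕ) : Set where
  field
    isFace     : Subset n → Bool
    downClosed : ∀ (σ τ : Subset n) → σ ⊆ τ → T (isFace τ) → T (isFace σ)
    singletons : ∀ (v : Fin n) → T (isFace ⁅ v ⁆)
open SimplicialComplex public

Face : ∀ {n} → SimplicialComplex n → Subset n → Set
Face Δ σ = T (isFace Δ σ)

-- f_j(Δ): number of faces of size j+1.  We define fsize Δ k = number of
-- faces with exactly k vertices, so f_{i-1}(Δ) = fsize Δ i.
fsize : ∀ {n} → SimplicialComplex n → ℕ → ℕ
fsize {n} Δ k =
  length (filter (λ σ → (∣ σ ∣ ℕ.≟ k) ×-dec T? (isFace Δ σ)) (allSubsets n))

-- Δ has dimension d-1: the maximal size of a face is d.
HasDimensionMinusOne : ∀ {n} → SimplicialComplex n → ℕ → Set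
HasDimensionMinusOne {n} Δ d =
  (∃ λ σ → Face Δ σ × ∣ σ ∣ ≡ d) × (∀ σ → Face Δ σ → ∣ σ ∣ ≤ d)

pair : ∀ {n} → Fin n → Fin n → Subset n
pair u v = ⁅ u ⁆ Data.Fin.Subset.∪ ⁅ v ⁆

IsClique : ∀ {n} → SimplicialComplex n → Subset n → Set
IsClique Δ τ = ∀ u v → u ∈ τ → v ∈ τ → u ≢ v → Face Δ (pair u v)

IsCritical : ∀ {n} → SimplicialComplex n → Subset n → Set
IsCritical Δ τ = ∃ λ v → v ∈ τ × Face Δ (τ - v)

IsBanner : ∀ {n} → ℕ → SimplicialComplex n → Set
IsBanner {n} i Δ =
  ∀ (τ : Subset n) → IsClique Δ τ → IsCritical Δ τ → suc i ≤ ∣ τ ∣ → Face Δ τ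

-- Γ(n,d): complete multipartite graph on Fin n whose d parts are the
-- residue classes mod d (sizes ⌈n/d⌉ or ⌊n/d⌋).  u,v adjacent iff
-- they are distinct and lie in different parts.
ΓAdj : ∀ {n} (d : ℕ) .{{_ : NonZero d}} → Fin n → Fin n → Set
ΓAdj d u v = (u ≢ v) × (toℕ u % d ≢ toℕ v % d)

IsΓClique : ∀ {n} (d : ℕ) .{{_ : NonZero d}} → Subset n → Set
IsΓClique d τ = ∀ u v → u ∈ τ → v ∈ τ → u ≢ v → ΓAdj d u v

isΓClique? : ∀ {n} (d : ℕ) .{{_ : NonZero d}} (τ : Subset n) → Dec (IsΓClique d τ)
isΓClique? d τ =
  all? λ u → all? λ v →
    (u ∈? τ) →-dec ((v ∈? τ) →-dec ((¬? (u F.≟ v)) →-dec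
      (¬? (u F.≟ v) ×-dec ¬? (toℕ u % d ℕ.≟ toℕ v % d))))

binomΓ : (n j d : ℕ) .{{_ : NonZero d}} → ℕ
binomΓ n j d =
  length (filter (λ τ → (∣ τ ∣ ℕ.≟ j) ×-dec isΓClique? d τ) (allSubsets n))

module Submission where

-- Both sides are bounded by / equal to elementary symmetric polynomials e_i.  The i-cliques
-- of Γ(n,d) are the sets on which the colouring x ↦ x mod d is injective; there are
-- e_i(c₀,…,c_{d-1}) of them, c_r being the sizes of the residue classes, which form the
-- balanced partition of n into d parts (RainbowSets, ResidueClasses).  For the complex we
-- prove, by induction on d, a bound for every "banner family": a down-closed family of vertex
-- sets whose faces of size ≥ k have at most d elements and extend by every vertex adjacent to
-- all their elements (BannerFamilies).  For a vertex v of maximal degree, the k-faces meeting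
-- a non-neighbour w of v number at most deg w ≤ deg v = #(k-1)-faces of the link of v, and the
-- remaining ones lie in the family induced on the neighbours of v; link and induced family
-- have smaller dimension.  The two inductive bounds combine because e_k is maximised, among
-- lists of given length and sum, by the balanced list (ElementarySymmetric).  Finally, the
-- faces of an i-banner complex form a banner family: the banner condition applies to σ ∪ {w},
-- a critical clique.


module Counting where
  open import Data.Nat using (ℕ; suc; _+_; _≤_; z≤n; s≤s)
  open import Data.Nat.Properties using (≤-antisym; ≤-trans; ≤-reflexive; m≤n⇒m≤1+n; +-mono-≤; +-suc)
  open import Data.List using (List; []; _∷_; _++_; map; filter; length)
  open import Data.List.Properties using (filter-++; length-++; filter-none; filter-all)
  open import Data.List.Relation.Unary.All using (universal)
  open import Data.Product using (_×_; _,_)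
  open import Data.Sum using (_⊎_; inj₁; inj₂)
  open import Data.Empty using (⊥-elim)
  open import Relation.Nullary using (¬_; Dec; yes; no)
  open import Relation.Nullary.Decidable using (_×-dec_; ¬?)
  open import Relation.Unary using (Decidable)
  open import Relation.Binary.PropositionalEquality using (_≡_; refl; sym; trans; cong)

  count : {A : Set} {P : A → Set} → Decidable P → List A → ℕ
  count P? xs = length (filter P? xs)

  indicator : {P : Set} → Dec P → ℕ
  indicator (yes _) = 1
  indicator (no _)  = 0

  indicator-yes : {P : Set} (P? : Dec P) → P → indicator P? ≡ 1
  indicator-yes (yes _) _ = refl
  indicator-yes (no ¬p) p = ⊥-elim (¬p p)

  indicator-no : {P : Set} (P? : Dec P) → ¬ P → indicator P? ≡ 0
  indicator-no (yes p) ¬p = ⊥-elim (¬p p)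
  indicator-no (no _)  _  = refl

  module _ {A : Set} where

    count-∷ : ∀ {P : A → Set} (P? : Decidable P) x xs → count P? (x ∷ xs) ≡ indicator (P? x) + count P? xs
    count-∷ P? x xs with P? x
    ... | yes _ = refl
    ... | no  _ = refl

    count-++ : ∀ {P : A → Set} (P? : Decidable P) xs ys → count P? (xs ++ ys) ≡ count P? xs + count P? ys
    count-++ P? xs ys = trans (cong length (filter-++ P? xs ys)) (length-++ (filter P? xs))

    count-mono : ∀ {P Q : A → Set} (P? : Decidable P) (Q? : Decidable Q) →
                 (∀ x → P x → Q x) → ∀ xs → count P? xs ≤ count Q? xs
    count-mono P? Q? P⇒Q [] = z≤n
    count-mono P? Q? P⇒Q (x ∷ xs) with P? x | Q? x
    ... | yes _ | yes _ = s≤s (count-mono P? Q? P⇒Q xs)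
    ... | yes p | no ¬q = ⊥-elim (¬q (P⇒Q x p))
    ... | no  _ | yes _ = m≤n⇒m≤1+n (count-mono P? Q? P⇒Q xs)
    ... | no  _ | no  _ = count-mono P? Q? P⇒Q xs

    count-cong : ∀ {P Q : A → Set} (P? : Decidable P) (Q? : Decidable Q) →
                 (∀ x → P x → Q x) → (∀ x → Q x → P x) → ∀ xs → count P? xs ≡ count Q? xs
    count-cong P? Q? P⇒Q Q⇒P xs = ≤-antisym (count-mono P? Q? P⇒Q xs) (count-mono Q? P? Q⇒P xs)

    count-none : ∀ {P : A → Set} (P? : Decidable P) → (∀ x → ¬ P x) → ∀ xs → count P? xs ≡ 0
    count-none P? ¬P xs = cong length (filter-none P? (universal ¬P xs))

    count-all : ∀ {P : A → Set} (P? : Decidable P) → (∀ x → P x) → ∀ xs → count P? xs ≡ length xs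
    count-all P? allP xs = cong length (filter-all P? (universal allP xs))

    count-split : ∀ {P Q : A → Set} (P? : Decidable P) (Q? : Decidable Q) xs →
                  count P? xs ≡ count (λ x → P? x ×-dec Q? x) xs + count (λ x → P? x ×-dec ¬? (Q? x)) xs
    count-split P? Q? [] = refl
    count-split P? Q? (x ∷ xs) with P? x | Q? x
    ... | yes _ | yes _ = cong suc (count-split P? Q? xs)
    ... | yes _ | no  _ = trans (cong suc (count-split P? Q? xs)) (sym (+-suc _ _))
    ... | no  _ | yes _ = count-split P? Q? xs
    ... | no  _ | no  _ = count-split P? Q? xs

    count-union : ∀ {P Q R : A → Set} (P? : Decidable P) (Q? : Decidable Q) (R? : Decidable R) →
                  (∀ x → R x → P x ⊎ Q x) → ∀ xs → count R? xs ≤ count P? xs + count Q? xs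
    count-union {P} {Q} {R} P? Q? R? R⇒P∪Q xs = ≤-trans (≤-reflexive (count-split R? P? xs))
      (+-mono-≤ (count-mono _ P? (λ _ (_ , p) → p) xs) (count-mono _ Q? inQ xs))
      where
        inQ : ∀ x → R x × ¬ P x → Q x
        inQ x (r , ¬p) with R⇒P∪Q x r
        ... | inj₁ p = ⊥-elim (¬p p)
        ... | inj₂ q = q

  count-map : ∀ {A B : Set} {P : B → Set} (P? : Decidable P) (f : A → B) xs →
              count P? (map f xs) ≡ count (λ x → P? (f x)) xs
  count-map P? f [] = refl
  count-map P? f (x ∷ xs) with P? (f x)
  ... | yes _ = cong suc (count-map P? f xs)
  ... | no  _ = count-map P? f xs

module ElementarySymmetric where
  open import Data.Nat using (ℕ; zero; suc; _+_; _*_; _≤_; _<_; z≤n; s≤s; _≤?_)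
  open import Data.Nat.Properties
  open import Data.Nat.ListAction using (sum)
  open import Data.Nat.ListAction.Properties using (sum-↭)
  open import Data.Nat.Induction using (<-rec)
  open import Data.Nat.Solver using (module +-*-Solver)
  open import Data.List using (List; []; _∷_; length; map)
  open import Data.List.Membership.Propositional using (_∈_)
  open import Data.List.Relation.Unary.Any using (here; there)
  open import Data.List.Relation.Unary.All using (All; []; _∷_; lookup; tabulate)
  open import Data.List.Relation.Binary.Pointwise using (Pointwise; []; _∷_)
  open import Data.List.Relation.Binary.Permutation.Propositional using (_↭_; refl; prep; swap; trans; ↭-sym)
  open import Data.List.Relation.Binary.Permutation.Propositional.Properties using (∈-resp-↭; ↭-length)
  open import Data.Product using (_×_; _,_; ∃₂)
  open import Data.Empty using (⊥-elim)
  open import Relation.Nullary using (yes; no)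
  open import Relation.Binary.PropositionalEquality using (_≡_; cong; cong₂; sym; subst₂; module ≡-Reasoning)
    renaming (refl to ≡-refl; trans to ≡-trans)

  esym : ℕ → List ℕ → ℕ
  esym zero    _        = 1
  esym (suc k) []       = 0
  esym (suc k) (x ∷ xs) = x * esym k xs + esym (suc k) xs

  esym-swap : ∀ k x y r → esym k (x ∷ y ∷ r) ≡ esym k (y ∷ x ∷ r)
  esym-swap zero          x y r = ≡-refl
  esym-swap (suc zero)    x y r =
    solve 3 (λ x y z → x :* con 1 :+ (y :* con 1 :+ z) := y :* con 1 :+ (x :* con 1 :+ z)) ≡-refl x y (esym 1 r)
    where open +-*-Solver
  esym-swap (suc (suc k)) x y r =
    solve 5 (λ x y a b c → x :* (y :* a :+ b) :+ (y :* b :+ c) := y :* (x :* a :+ b) :+ (x :* b :+ c)) ≡-refl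
      x y (esym k r) (esym (suc k) r) (esym (suc (suc k)) r)
    where open +-*-Solver

  esym-cons : ∀ x {xs ys} → (∀ k → esym k xs ≡ esym k ys) → ∀ k → esym k (x ∷ xs) ≡ esym k (x ∷ ys)
  esym-cons x eq zero    = ≡-refl
  esym-cons x eq (suc k) = cong₂ _+_ (cong (x *_) (eq k)) (eq (suc k))

  esym-↭ : ∀ {xs ys} → xs ↭ ys → ∀ k → esym k xs ≡ esym k ys
  esym-↭ refl         k = ≡-refl
  esym-↭ (prep x p)   k = esym-cons x (esym-↭ p) k
  esym-↭ (swap x y p) k = ≡-trans (esym-cons x (esym-cons y (esym-↭ p)) k) (esym-swap k x y _)
  esym-↭ (trans p q)  k = ≡-trans (esym-↭ p k) (esym-↭ q k)

  esym-mono : ∀ {xs ys} → Pointwise _≤_ xs ys → ∀ k → esym k xs ≤ esym k ys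
  esym-mono p         zero    = ≤-refl
  esym-mono []        (suc k) = ≤-refl
  esym-mono (x≤y ∷ p) (suc k) = +-mono-≤ (*-mono-≤ x≤y (esym-mono p k)) (esym-mono p (suc k))

  esym-suc-head : ∀ k x r → esym (suc k) (suc x ∷ r) ≡ esym (suc k) (x ∷ r) + esym k r
  esym-suc-head k x r =
    solve 3 (λ x a b → (con 1 :+ x) :* a :+ b := (x :* a :+ b) :+ a) ≡-refl x (esym k r) (esym (suc k) r)
    where open +-*-Solver

  esym-dominated : ∀ k {xs ys} → length xs ≡ length ys →
                   (∀ {x y} → x ∈ xs → y ∈ ys → x ≤ y) → esym k xs ≤ esym k ys
  esym-dominated k len dom = esym-mono (pointwise len dom) k
    where
      pointwise : ∀ {xs ys} → length xs ≡ length ys → (∀ {x y} → x ∈ xs → y ∈ ys → x ≤ y) → Pointwise _≤_ xs ys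
      pointwise {[]}     {[]}     _   _   = []
      pointwise {x ∷ xs} {y ∷ ys} len dom =
        dom (here ≡-refl) (here ≡-refl) ∷ pointwise (suc-injective len) (λ p q → dom (there p) (there q))

  Balanced : List ℕ → Set
  Balanced b = ∀ {x y} → x ∈ b → y ∈ b → x ≤ suc y

  balanced-↭ : ∀ {xs ys} → xs ↭ ys → Balanced xs → Balanced ys
  balanced-↭ p bal x∈ y∈ = bal (∈-resp-↭ (↭-sym p) x∈) (∈-resp-↭ (↭-sym p) y∈)

  balanced-tail : ∀ {x xs} → Balanced (x ∷ xs) → Balanced xs
  balanced-tail bal x∈ y∈ = bal (there x∈) (there y∈)

  balanced-lower-max : ∀ {y rb} → All (_≤ suc y) rb → Balanced (suc y ∷ rb) → Balanced (y ∷ rb)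
  balanced-lower-max max bal (here ≡-refl) (here ≡-refl) = n≤1+n _
  balanced-lower-max max bal (here ≡-refl) (there q)     = m≤n⇒m≤1+n (≤-pred (bal (here ≡-refl) (there q)))
  balanced-lower-max max bal (there p)     (here ≡-refl) = lookup max p
  balanced-lower-max max bal (there p)     (there q)     = bal (there p) (there q)

  head-bounds : ∀ {m r z} → All (_≤ m) r → z ∈ m ∷ r → z ≤ m
  head-bounds max (here ≡-refl) = ≤-refl
  head-bounds max (there p)     = lookup max p

  max-split : ∀ x xs → ∃₂ λ m r → (x ∷ xs ↭ m ∷ r) × All (_≤ m) r
  max-split x [] = x , [] , refl , []
  max-split x (y ∷ ys) with max-split y ys
  ... | m , r , p , max with x ≤? m
  ...   | yes x≤m = m , x ∷ r , trans (prep x p) (swap x m refl) , x≤m ∷ max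
  ...   | no  x≰m = x , y ∷ ys , refl ,
          tabulate (λ z∈ → ≤-trans (head-bounds max (∈-resp-↭ p z∈)) (<⇒≤ (≰⇒> x≰m)))

  sum-bounded : ∀ {m r} → All (_≤ m) r → sum r ≤ length r * m
  sum-bounded []          = z≤n
  sum-bounded (x≤m ∷ max) = +-mono-≤ x≤m (sum-bounded max)

  private
    Claim : ℕ → Set
    Claim s = ∀ k {a b} → sum b ≡ s → length a ≡ length b → sum a ≤ sum b → Balanced b →
              esym k a ≤ esym k b

    -- If the maximum of a is
    -- below every entry of b we compare entrywise; otherwise both maxima are lowered by one,
    -- splitting esym (k+1) by esym-suc-head into two instances of smaller sum.
    claim-step : ∀ {s} → (∀ {t} → t < s → Claim t) →
                 ∀ k {m ra y rb} → All (_≤ m) ra → All (_≤ y) rb → Balanced (y ∷ rb) →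
                 sum (y ∷ rb) ≡ s → length ra ≡ length rb → sum (m ∷ ra) ≤ sum (y ∷ rb) →
                 esym k (m ∷ ra) ≤ esym k (y ∷ rb)
    claim-step ih zero _ _ _ _ _ _ = ≤-refl
    claim-step ih (suc k) {zero} {ra} {y} {rb} ma mb bal eq len le =
      esym-dominated (suc k) {0 ∷ ra} {y ∷ rb} (cong suc len) (λ x∈ _ → ≤-trans (head-bounds ma x∈) z≤n)
    claim-step ih (suc k) {suc m} {ra} {zero} {rb} ma mb bal eq len le =
      ⊥-elim (n≮0 (≤-trans le (≤-trans (sum-bounded mb) (≤-reflexive (*-zeroʳ (length rb))))))
    claim-step ih (suc k) {suc m} {ra} {suc y} {rb} ma mb bal ≡-refl len le with suc m ≤? y
    ... | yes m<y = esym-dominated (suc k) (cong suc len)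
                      (λ x∈ z∈ → ≤-trans (head-bounds ma x∈) (≤-trans m<y (≤-pred (bal (here ≡-refl) z∈))))
    ... | no  m≮y = begin
        esym (suc k) (suc m ∷ ra)            ≡⟨ esym-suc-head k m ra ⟩
        esym (suc k) (m ∷ ra) + esym k ra    ≤⟨ +-mono-≤ lowered rest ⟩
        esym (suc k) (y ∷ rb) + esym k rb    ≡⟨ sym (esym-suc-head k y rb) ⟩
        esym (suc k) (suc y ∷ rb)            ∎
      where
        open ≤-Reasoning
        y≤m : y ≤ m
        y≤m = ≤-pred (≰⇒> m≮y)
        lowered : esym (suc k) (m ∷ ra) ≤ esym (suc k) (y ∷ rb)
        lowered = ih (n<1+n _) (suc k) {m ∷ ra} {y ∷ rb} ≡-refl (cong suc len) (≤-pred le) (balanced-lower-max mb bal)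
        sum-rest : sum ra ≤ sum rb
        sum-rest = +-cancelˡ-≤ (suc y) (sum ra) (sum rb) (≤-trans (+-monoˡ-≤ (sum ra) (s≤s y≤m)) le)
        rest : esym k ra ≤ esym k rb
        rest = ih (s≤s (m≤n+m (sum rb) y)) k {ra} {rb} ≡-refl len sum-rest (balanced-tail bal)

  esym-balanced-max : ∀ k {a b} → length a ≡ length b → sum a ≤ sum b → Balanced b →
                      esym k a ≤ esym k b
  esym-balanced-max k {a} {b} = <-rec Claim claim (sum b) k ≡-refl
    where
      claim : ∀ s → (∀ {t} → t < s → Claim t) → Claim s
      claim s ih k {[]}     {[]}      eq len le bal = ≤-refl
      claim s ih k {x ∷ xs} {y₀ ∷ ys} eq len le bal with max-split x xs | max-split y₀ ys
      ... | m , ra , pa , ma | y , rb , pb , mb =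
        subst₂ _≤_ (esym-↭ (↭-sym pa) k) (esym-↭ (↭-sym pb) k)
          (claim-step ih k ma mb (balanced-↭ pb bal) (≡-trans (sym (sum-↭ pb)) eq)
            (suc-injective (≡-trans (sym (↭-length pa)) (≡-trans len (↭-length pb))))
            (subst₂ _≤_ (sum-↭ pa) (sum-↭ pb) le))

  esym-zeros : ∀ k {A : Set} (xs : List A) → esym (suc k) (map (λ _ → 0) xs) ≡ 0
  esym-zeros k []       = ≡-refl
  esym-zeros k (_ ∷ xs) = esym-zeros k xs

module ResidueClasses where
  open import Data.Nat using (ℕ; zero; suc; _+_; _∸_; _≤_; _<_; z≤n; s≤s; _≟_; _<?_; _%_; _/_; NonZero)
  open import Data.Nat.Properties
  open import Data.Nat.DivMod using (m≡m%n+[m/n]*n; [m+kn]%n≡m%n; m<n⇒m%n≡m; n%n≡0; m%n<n)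
  open import Data.Nat.ListAction using (sum)
  open import Data.List using (List; []; _∷_; [_]; _++_; map; length; upTo)
  open import Data.List.Properties using (map-cong; length-map; length-upTo; upTo-∷ʳ)
  open import Data.List.Membership.Propositional using (_∈_; _∉_)
  open import Data.List.Membership.Propositional.Properties using (∈-map⁻; ∈-upTo⁺; ∈-upTo⁻)
  open import Data.List.Relation.Unary.Any using (here; there)
  open import Data.List.Relation.Unary.All.Properties using (All¬⇒¬Any)
  open import Data.List.Relation.Unary.Unique.Propositional using (Unique; []; _∷_)
  open import Data.List.Relation.Unary.Unique.Propositional.Properties using (upTo⁺)
  open import Data.Product using (∃; _,_)
  open import Data.Empty using (⊥-elim)
  open import Relation.Nullary using (Dec; yes; no)
  open import Relation.Binary.PropositionalEquality
    using (_≡_; refl; sym; trans; cong; cong₂; subst; subst₂; module ≡-Reasoning)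
  open import Algebra.Properties.CommutativeSemigroup +-commutativeSemigroup using (interchange)

  open Counting
  open ElementarySymmetric using (Balanced; esym; esym-balanced-max)

  colourClasses : {A : Set} → (A → ℕ) → List ℕ → List A → List ℕ
  colourClasses c cs xs = map (λ r → count (λ x → c x ≟ r) xs) cs

  private
    sum-map-+ : (f g : ℕ → ℕ) (cs : List ℕ) → sum (map (λ r → f r + g r) cs) ≡ sum (map f cs) + sum (map g cs)
    sum-map-+ f g []       = refl
    sum-map-+ f g (r ∷ cs) = trans (cong (f r + g r +_) (sum-map-+ f g cs)) (interchange (f r) (g r) _ _)

    sum-map-0 : (cs : List ℕ) → sum (map (λ _ → 0) cs) ≡ 0
    sum-map-0 []       = refl
    sum-map-0 (_ ∷ cs) = sum-map-0 cs

    sum-indicator-∉ : ∀ t cs → t ∉ cs → sum (map (λ r → indicator (t ≟ r)) cs) ≡ 0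
    sum-indicator-∉ t []       _   = refl
    sum-indicator-∉ t (r ∷ cs) t∉ with t ≟ r
    ... | yes t≡r = ⊥-elim (t∉ (here t≡r))
    ... | no  _   = sum-indicator-∉ t cs (λ t∈ → t∉ (there t∈))

    sum-indicator-∈ : ∀ t {cs} → Unique cs → t ∈ cs → sum (map (λ r → indicator (t ≟ r)) cs) ≡ 1
    sum-indicator-∈ t {r ∷ cs} (r∉cs ∷ uniq) t∈ with t ≟ r | t∈
    ... | yes refl | _         = cong suc (sum-indicator-∉ t cs (All¬⇒¬Any r∉cs))
    ... | no  t≢r  | here t≡r  = ⊥-elim (t≢r t≡r)
    ... | no  _    | there t∈′ = sum-indicator-∈ t uniq t∈′

  sum-colourClasses : {A : Set} (c : A → ℕ) {cs : List ℕ} → Unique cs → ∀ xs →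
                      (∀ x → c x ∈ cs) → sum (colourClasses c cs xs) ≡ length xs
  sum-colourClasses c {cs} uniq []       coloured = sum-map-0 cs
  sum-colourClasses c {cs} uniq (x ∷ xs) coloured = begin
    sum (colourClasses c cs (x ∷ xs))
      ≡⟨ cong sum (map-cong (λ r → count-∷ (λ y → c y ≟ r) x xs) cs) ⟩
    sum (map (λ r → indicator (c x ≟ r) + count (λ y → c y ≟ r) xs) cs)
      ≡⟨ sum-map-+ _ _ cs ⟩
    sum (map (λ r → indicator (c x ≟ r)) cs) + sum (colourClasses c cs xs)
      ≡⟨ cong₂ _+_ (sum-indicator-∈ (c x) uniq (coloured x)) (sum-colourClasses c uniq xs coloured) ⟩
    suc (length xs) ∎
    where open ≡-Reasoning

  residueCount : (d : ℕ) .{{_ : NonZero d}} → ℕ → ℕ → ℕ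
  residueCount d u r = count (λ x → x % d ≟ r) (upTo u)

  -- classSizes d u: the sizes of the d residue classes modulo d of {0, …, u-1};
  -- this is the balanced partition of u into d parts (empty when d = 0).
  classSizes : ℕ → ℕ → List ℕ
  classSizes zero    u = []
  classSizes (suc D) u = colourClasses (_% suc D) (upTo (suc D)) (upTo u)

  length-classSizes : ∀ d u → length (classSizes d u) ≡ d
  length-classSizes zero    u = refl
  length-classSizes (suc D) u = trans (length-map _ (upTo (suc D))) (length-upTo (suc D))

  sum-classSizes : ∀ D u → sum (classSizes (suc D) u) ≡ u
  sum-classSizes D u =
    trans (sum-colourClasses (_% suc D) (upTo⁺ (suc D)) (upTo u) (λ x → ∈-upTo⁺ (m%n<n x (suc D))))
          (length-upTo u)

  private
    mod-suc : ∀ u D → suc u % suc D ≡ suc (u % suc D) % suc D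
    mod-suc u D = trans (cong (λ z → suc z % suc D) (m≡m%n+[m/n]*n u (suc D)))
                        ([m+kn]%n≡m%n (suc (u % suc D)) (u / suc D) (suc D))

    mod-suc-< : ∀ u D → u % suc D < D → suc u % suc D ≡ suc (u % suc D)
    mod-suc-< u D lt = trans (mod-suc u D) (m<n⇒m%n≡m (s≤s lt))

    mod-suc-max : ∀ u D → u % suc D ≡ D → suc u % suc D ≡ 0
    mod-suc-max u D eq = trans (mod-suc u D) (trans (cong (λ z → suc z % suc D) eq) (n%n≡0 (suc D)))

    indicator-step : ∀ r t → indicator (r <? t) + indicator (t ≟ r) ≡ indicator (r <? suc t)
    indicator-step r t with r <? t | t ≟ r
    ... | yes r<t | yes refl = ⊥-elim (<-irrefl refl r<t)
    ... | yes r<t | no  _    = sym (indicator-yes (r <? suc t) (m<n⇒m<1+n r<t))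
    ... | no  _   | yes refl = sym (indicator-yes (r <? suc r) ≤-refl)
    ... | no  r≮t | no  t≢r  = sym (indicator-no (r <? suc t) (λ r<1+t → r≮t (≤∧≢⇒< (≤-pred r<1+t) (λ r≡t → t≢r (sym r≡t)))))

  residueCount-suc : ∀ d .{{_ : NonZero d}} u r →
                     residueCount d (suc u) r ≡ residueCount d u r + indicator (u % d ≟ r)
  residueCount-suc d u r = begin
    count P? (upTo (suc u))                    ≡⟨ cong (count P?) (sym (upTo-∷ʳ u)) ⟩
    count P? (upTo u ++ [ u ])                 ≡⟨ count-++ P? (upTo u) [ u ] ⟩
    count P? (upTo u) + count P? [ u ]         ≡⟨ cong (count P? (upTo u) +_) (trans (count-∷ P? u []) (+-identityʳ _)) ⟩
    count P? (upTo u) + indicator (u % d ≟ r)  ∎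
    where
      open ≡-Reasoning
      P? = λ x → x % d ≟ r

  Profile : ℕ → ℕ → ℕ → Set
  Profile D u q = ∀ r → r < suc D → residueCount (suc D) u r ≡ q + indicator (r <? u % suc D)

  private
    profile-suc : ∀ D u q → Profile D u q → ∀ r → r < suc D →
                  residueCount (suc D) (suc u) r ≡ q + indicator (r <? suc (u % suc D))
    profile-suc D u q profile r r<d = begin
      residueCount (suc D) (suc u) r                ≡⟨ residueCount-suc (suc D) u r ⟩
      residueCount (suc D) u r + indicator (t ≟ r)  ≡⟨ cong (_+ indicator (t ≟ r)) (profile r r<d) ⟩
      q + indicator (r <? t) + indicator (t ≟ r)    ≡⟨ +-assoc q _ _ ⟩
      q + (indicator (r <? t) + indicator (t ≟ r))  ≡⟨ cong (q +_) (indicator-step r t) ⟩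
      q + indicator (r <? suc t)                    ∎
      where
        open ≡-Reasoning
        t = u % suc D

  residue-profile : ∀ D u → ∃ (Profile D u)
  residue-profile D zero = 0 , λ r _ → sym (indicator-no (r <? 0) λ ())
  residue-profile D (suc u) with residue-profile D u | u % suc D <? D
  ... | q , profile | yes t<D = q , λ r r<d →
    trans (profile-suc D u q profile r r<d) (cong (λ z → q + indicator (r <? z)) (sym (mod-suc-< u D t<D)))
  ... | q , profile | no  t≮D = suc q , λ r r<d → begin
      residueCount (suc D) (suc u) r          ≡⟨ profile-suc D u q profile r r<d ⟩
      q + indicator (r <? suc t)              ≡⟨ cong (q +_) (indicator-yes (r <? suc t) (subst (λ z → r < suc z) (sym t≡D) r<d)) ⟩
      q + 1                                   ≡⟨ +-comm q 1 ⟩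
      suc q                                   ≡⟨ sym (+-identityʳ (suc q)) ⟩
      suc q + 0                               ≡⟨ cong (suc q +_) (sym (indicator-no (r <? suc u % suc D)
                                                   λ r<0 → n≮0 (subst (r <_) (mod-suc-max u D t≡D) r<0))) ⟩
      suc q + indicator (r <? suc u % suc D)  ∎
    where
      open ≡-Reasoning
      t = u % suc D
      t≡D : t ≡ D
      t≡D = ≤-antisym (≤-pred (m%n<n u (suc D))) (≮⇒≥ t≮D)

  classSizes-balanced : ∀ D u → Balanced (classSizes (suc D) u)
  classSizes-balanced D u x∈ y∈ with residue-profile D u | ∈-map⁻ _ x∈ | ∈-map⁻ _ y∈
  ... | q , profile | r , r∈ , refl | s , s∈ , refl =
    subst₂ _≤_ (sym (profile r (∈-upTo⁻ r∈))) (cong suc (sym (profile s (∈-upTo⁻ s∈))))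
      (≤-trans (+-monoʳ-≤ q (indicator≤1 (r <? u % suc D))) (≤-trans (≤-reflexive (+-comm q 1)) (s≤s (m≤m+n q _))))
    where
      indicator≤1 : ∀ {P : Set} (P? : Dec P) → indicator P? ≤ 1
      indicator≤1 (yes _) = ≤-refl
      indicator≤1 (no _)  = z≤n

  sum-classSizes-≤ : ∀ d u → sum (classSizes d u) ≤ u
  sum-classSizes-≤ zero    u = z≤n
  sum-classSizes-≤ (suc D) u = ≤-reflexive (sum-classSizes D u)

  esym-split-part : ∀ k D {m u} → m ≤ u → esym k ((u ∸ m) ∷ classSizes D m) ≤ esym k (classSizes (suc D) u)
  esym-split-part k D {m} {u} m≤u = esym-balanced-max k
    (trans (cong suc (length-classSizes D m)) (sym (length-classSizes (suc D) u)))
    (begin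
      (u ∸ m) + sum (classSizes D m) ≤⟨ +-monoʳ-≤ (u ∸ m) (sum-classSizes-≤ D m) ⟩
      (u ∸ m) + m                    ≡⟨ m∸n+n≡m m≤u ⟩
      u                              ≡⟨ sym (sum-classSizes D u) ⟩
      sum (classSizes (suc D) u)     ∎)
    (classSizes-balanced D u)
    where open ≤-Reasoning

module Subsets where
  open import Defs using (allSubsets; pair)
  open import Data.Bool using (true; false)
  open import Data.Nat using (zero; suc; _+_; _≤_; _≟_)
  open import Data.Nat.Properties using (+-comm)
  open import Data.Fin using (Fin; zero; suc)
  open import Data.Fin.Subset using (Subset; ∣_∣; _∈_; _∉_; _⊆_; ⁅_⁆; _-_; inside)
  open import Data.Fin.Subset.Properties using (_∈?_; x∈⁅x⁆; x∈⁅y⁆⇒x≡y; x∈p∪q⁻; x∈p∪q⁺; drop-there; p─⊥≡p)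
  open import Data.Vec using (_∷_; here; there; _[_]≔_)
  open import Data.Vec.Properties using ([]≔-updates)
  open import Data.List using (map)
  open import Data.Product using (_,_; Σ)
  open import Data.Sum using (_⊎_; inj₁; inj₂)
  open import Data.Empty using (⊥-elim)
  open import Relation.Nullary.Decidable using (_×-dec_; ¬?)
  open import Relation.Unary using (Decidable)
  open import Relation.Binary.PropositionalEquality using (_≡_; refl; sym; trans; cong; cong₂; subst)

  open Counting

  count-allSubsets : ∀ {n} {P : Subset (suc n) → Set} (P? : Decidable P) →
    count P? (allSubsets (suc n)) ≡ count (λ s → P? (true ∷ s)) (allSubsets n) + count (λ s → P? (false ∷ s)) (allSubsets n)
  count-allSubsets {n} P? =
    trans (count-++ P? (map (true ∷_) (allSubsets n)) (map (false ∷_) (allSubsets n)))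
          (cong₂ _+_ (count-map P? (true ∷_) (allSubsets n)) (count-map P? (false ∷_) (allSubsets n)))

  count-size-zero : ∀ n → count (λ σ → ∣ σ ∣ ≟ 0) (allSubsets n) ≡ 1
  count-size-zero zero    = refl
  count-size-zero (suc n) = trans (count-allSubsets {n} (λ σ → ∣ σ ∣ ≟ 0))
    (cong₂ _+_ (count-none (λ s → ∣ true ∷ s ∣ ≟ 0) (λ _ ()) (allSubsets n)) (count-size-zero n))

  member : ∀ {n} (σ : Subset n) {k} → suc k ≤ ∣ σ ∣ → Σ (Fin n) (_∈ σ)
  member (true  ∷ s) _ = zero , here
  member (false ∷ s) h with member s h
  ... | x , x∈ = suc x , there x∈

  ins : ∀ {n} → Fin n → Subset n → Subset n
  ins w σ = σ [ w ]≔ inside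

  ins-∈ : ∀ {n} (w : Fin n) σ → w ∈ ins w σ
  ins-∈ w σ = []≔-updates σ w

  ins-⊇ : ∀ {n} (w : Fin n) σ {x} → x ∈ σ → x ∈ ins w σ
  ins-⊇ zero    (b ∷ s) here      = here
  ins-⊇ zero    (b ∷ s) (there p) = there p
  ins-⊇ (suc w) (b ∷ s) here      = here
  ins-⊇ (suc w) (b ∷ s) (there p) = there (ins-⊇ w s p)

  ins-⁻ : ∀ {n} (w : Fin n) σ {x} → x ∈ ins w σ → x ≡ w ⊎ x ∈ σ
  ins-⁻ zero    (b ∷ s) here      = inj₁ refl
  ins-⁻ zero    (b ∷ s) (there p) = inj₂ (there p)
  ins-⁻ (suc w) (b ∷ s) here      = inj₂ here
  ins-⁻ (suc w) (b ∷ s) (there p) with ins-⁻ w s p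
  ... | inj₁ eq = inj₁ (cong suc eq)
  ... | inj₂ q  = inj₂ (there q)

  ins-size : ∀ {n} (w : Fin n) σ → w ∉ σ → ∣ ins w σ ∣ ≡ suc ∣ σ ∣
  ins-size zero    (true  ∷ s) w∉ = ⊥-elim (w∉ here)
  ins-size zero    (false ∷ s) w∉ = refl
  ins-size (suc w) (true  ∷ s) w∉ = cong suc (ins-size w s (λ p → w∉ (there p)))
  ins-size (suc w) (false ∷ s) w∉ = ins-size w s (λ p → w∉ (there p))

  ins-remove : ∀ {n} (w : Fin n) σ → (ins w σ - w) ⊆ σ
  ins-remove zero    (b ∷ s)     (there p) = there (subst (_ ∈_) (p─⊥≡p s) p)
  ins-remove (suc w) (true  ∷ s) here      = here
  ins-remove (suc w) (b ∷ s)     (there p) = there (ins-remove w s p)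

  ins-mono : ∀ {n} (v : Fin n) {σ τ} → σ ⊆ τ → ins v σ ⊆ ins v τ
  ins-mono v {σ} {τ} σ⊆τ x∈ with ins-⁻ v σ x∈
  ... | inj₁ refl = ins-∈ v τ
  ... | inj₂ p    = ins-⊇ v τ (σ⊆τ p)

  ins-comm : ∀ {n} (v w : Fin n) σ → ins v (ins w σ) ⊆ ins w (ins v σ)
  ins-comm v w σ x∈ with ins-⁻ v (ins w σ) x∈
  ... | inj₁ refl = ins-⊇ w (ins v σ) (ins-∈ v σ)
  ... | inj₂ p with ins-⁻ w σ p
  ...   | inj₁ refl = ins-∈ w (ins v σ)
  ...   | inj₂ q    = ins-⊇ w (ins v σ) (ins-⊇ v σ q)

  pair-⁻ : ∀ {n} (u v : Fin n) {x} → x ∈ pair u v → x ≡ u ⊎ x ≡ v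
  pair-⁻ u v p with x∈p∪q⁻ ⁅ u ⁆ ⁅ v ⁆ p
  ... | inj₁ q = inj₁ (x∈⁅y⁆⇒x≡y u q)
  ... | inj₂ q = inj₂ (x∈⁅y⁆⇒x≡y v q)

  pair-⊆ : ∀ {n} {u v : Fin n} {σ} → u ∈ σ → v ∈ σ → pair u v ⊆ σ
  pair-⊆ {u = u} {v} u∈ v∈ x∈ with pair-⁻ u v x∈
  ... | inj₁ refl = u∈
  ... | inj₂ refl = v∈

  pair-sym : ∀ {n} (u v : Fin n) → pair u v ⊆ pair v u
  pair-sym u v = pair-⊆ (x∈p∪q⁺ (inj₂ (x∈⁅x⁆ u))) (x∈p∪q⁺ (inj₁ (x∈⁅x⁆ v)))

  singleton-⊆-pair : ∀ {n} (u v : Fin n) → ⁅ u ⁆ ⊆ pair u v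
  singleton-⊆-pair u v x∈ = x∈p∪q⁺ (inj₁ x∈)

  count-containing : ∀ {n} (v : Fin n) {A : Subset n → Set} (A? : Decidable A) →
    count (λ σ → A? σ ×-dec (v ∈? σ)) (allSubsets n) ≡ count (λ τ → ¬? (v ∈? τ) ×-dec A? (ins v τ)) (allSubsets n)
  count-containing {suc n} zero A? =
    trans (count-allSubsets (λ σ → A? σ ×-dec (zero ∈? σ)))
    (trans (cong₂ _+_ (count-cong _ (λ s → A? (true ∷ s)) (λ _ (a , _) → a) (λ _ a → a , here) (allSubsets n))
                      (count-none _ (λ { _ (_ , ()) }) (allSubsets n)))
    (trans (+-comm _ 0)
    (sym (trans (count-allSubsets (λ τ → ¬? (zero ∈? τ) ×-dec A? (ins zero τ)))
      (cong₂ _+_ (count-none _ (λ _ (v∉ , _) → v∉ here) (allSubsets n))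
                 (count-cong _ (λ s → A? (true ∷ s)) (λ _ (_ , a) → a) (λ _ a → (λ ()) , a) (allSubsets n)))))))
  count-containing {suc n} (suc v) A? =
    trans (count-allSubsets (λ σ → A? σ ×-dec (suc v ∈? σ)))
    (trans (cong₂ _+_ (shift (λ s → A? (true ∷ s))) (shift (λ s → A? (false ∷ s))))
    (sym (trans (count-allSubsets (λ τ → ¬? (suc v ∈? τ) ×-dec A? (ins (suc v) τ)))
      (cong₂ _+_ (unshift (λ s → A? (true ∷ ins v s))) (unshift (λ s → A? (false ∷ ins v s)))))))
    where
      shift : ∀ {B : Subset n → Set} (B? : Decidable B) {b} →
              count (λ s → B? s ×-dec (suc v ∈? (b ∷ s))) (allSubsets n)
                ≡ count (λ τ → ¬? (v ∈? τ) ×-dec B? (ins v τ)) (allSubsets n)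
      shift B? = trans (count-cong _ (λ s → B? s ×-dec (v ∈? s)) (λ _ (a , p) → a , drop-there p)
                                     (λ _ (a , p) → a , there p) (allSubsets n))
                       (count-containing v B?)
      unshift : ∀ {B : Subset n → Set} (B? : Decidable B) {b} →
                count (λ s → ¬? (suc v ∈? (b ∷ s)) ×-dec B? s) (allSubsets n)
                  ≡ count (λ s → ¬? (v ∈? s) ×-dec B? s) (allSubsets n)
      unshift B? = count-cong _ _ (λ _ (v∉ , a) → (λ p → v∉ (there p)) , a)
                                  (λ _ (v∉ , a) → (λ p → v∉ (drop-there p)) , a) (allSubsets n)

module RainbowSets where
  open import Defs using (allSubsets)
  open import Data.Bool using (true; false)
  open import Data.Nat using (ℕ; zero; suc; _+_; _≟_)
  open import Data.Nat.Properties using (+-comm; suc-injective; 1+n≢0)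
  open import Data.Fin using (Fin; zero; suc)
  import Data.Fin.Properties as Fin
  open import Data.Fin.Subset using (Subset; ∣_∣) renaming (_∈_ to _∈ₛ_)
  open import Data.Fin.Subset.Properties using () renaming (_∈?_ to _∈ₛ?_)
  open import Data.Vec using (here; there) renaming ([] to []ᵥ; _∷_ to _∷ᵥ_)
  open import Data.List using (List; _∷_; _++_; map; allFin; tabulate)
  open import Data.List.Properties using (map-tabulate; map-cong-local)
  open import Data.List.Membership.Propositional using (_∈_; _∉_)
  open import Data.List.Membership.DecPropositional _≟_ using (_∈?_)
  open import Data.List.Membership.Propositional.Properties using (∈-∃++)
  open import Data.List.Relation.Unary.Any using (here; there)
  open import Data.List.Relation.Unary.All using () renaming (tabulate to all-tabulate)
  open import Data.List.Relation.Unary.All.Properties using (All¬⇒¬Any)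
  open import Data.List.Relation.Unary.Unique.Propositional using (Unique; _∷_)
  open import Data.List.Relation.Binary.Permutation.Propositional using (_↭_; ↭-sym; ↭⇒↭ₛ)
  open import Data.List.Relation.Binary.Permutation.Propositional.Properties using (∈-resp-↭; shift; map⁺)
  open import Relation.Binary.PropositionalEquality.Properties using (setoid)
  open import Data.List.Relation.Binary.Permutation.Setoid.Properties (setoid ℕ) using (Unique-resp-↭)
  open import Data.Product using (_×_; _,_; ∃)
  open import Data.Empty using (⊥-elim)
  open import Relation.Nullary using (¬_; Dec; yes; no)
  open import Relation.Nullary.Decidable using (_×-dec_; _→-dec_; ¬?)
  open import Relation.Binary.PropositionalEquality using (_≡_; _≢_; refl; sym; trans; cong; cong₂; subst; module ≡-Reasoning)

  open Counting
  open ElementarySymmetric using (esym; esym-↭; esym-suc-head; esym-zeros)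
  open ResidueClasses using (colourClasses)
  open Subsets using (count-allSubsets)

  Rainbow : ∀ {n} → (Fin n → ℕ) → List ℕ → Subset n → Set
  Rainbow c cols τ = (∀ u v → u ∈ₛ τ → v ∈ₛ τ → u ≢ v → c u ≢ c v) × (∀ u → u ∈ₛ τ → c u ∈ cols)

  rainbow? : ∀ {n} (c : Fin n → ℕ) cols τ → Dec (Rainbow c cols τ)
  rainbow? c cols τ =
    Fin.all? (λ u → Fin.all? λ v → (u ∈ₛ? τ) →-dec ((v ∈ₛ? τ) →-dec (¬? (u Fin.≟ v) →-dec ¬? (c u ≟ c v))))
    ×-dec Fin.all? (λ u → (u ∈ₛ? τ) →-dec (c u ∈? cols))

  rainbowOfSize? : ∀ {n} (c : Fin n → ℕ) cols k (τ : Subset n) → Dec (∣ τ ∣ ≡ k × Rainbow c cols τ)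
  rainbowOfSize? c cols k τ = (∣ τ ∣ ≟ k) ×-dec rainbow? c cols τ

  extract : ∀ {x : ℕ} {xs} → x ∈ xs → ∃ λ rest → xs ↭ x ∷ rest
  extract x∈ with ys , zs , refl ← ∈-∃++ x∈ = ys ++ zs , shift _ ys zs

  colourCount-suc : ∀ {n} (c : Fin (suc n) → ℕ) r →
    count (λ x → c x ≟ r) (allFin (suc n)) ≡ indicator (c zero ≟ r) + count (λ x → c (suc x) ≟ r) (allFin n)
  colourCount-suc {n} c r = begin
    count (λ x → c x ≟ r) (zero ∷ tabulate suc)
      ≡⟨ count-∷ (λ x → c x ≟ r) zero (tabulate suc) ⟩
    indicator (c zero ≟ r) + count (λ x → c x ≟ r) (tabulate suc)
      ≡⟨ cong (λ xs → indicator (c zero ≟ r) + count (λ x → c x ≟ r) xs) (sym (map-tabulate (λ x → x) suc)) ⟩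
    indicator (c zero ≟ r) + count (λ x → c x ≟ r) (map suc (allFin n))
      ≡⟨ cong (indicator (c zero ≟ r) +_) (count-map (λ x → c x ≟ r) suc (allFin n)) ⟩
    indicator (c zero ≟ r) + count (λ x → c (suc x) ≟ r) (allFin n) ∎
    where open ≡-Reasoning

  colourClasses-drop : ∀ {n} (c : Fin (suc n) → ℕ) cs → c zero ∉ cs →
    colourClasses c cs (allFin (suc n)) ≡ colourClasses (λ x → c (suc x)) cs (allFin n)
  colourClasses-drop c cs c₀∉ = map-cong-local (all-tabulate λ {r} r∈ → trans (colourCount-suc c r)
    (cong (_+ count (λ x → c (suc x) ≟ r) (allFin _)) (indicator-no (c zero ≟ r) λ c₀≡r → c₀∉ (subst (_∈ cs) (sym c₀≡r) r∈))))

  colourClasses-front : ∀ {n} (c : Fin (suc n) → ℕ) rest → c zero ∉ rest →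
    colourClasses c (c zero ∷ rest) (allFin (suc n))
      ≡ suc (count (λ x → c (suc x) ≟ c zero) (allFin n)) ∷ colourClasses (λ x → c (suc x)) rest (allFin n)
  colourClasses-front c rest c₀∉ =
    cong₂ _∷_ (trans (colourCount-suc c (c zero)) (cong (_+ count (λ x → c (suc x) ≟ c zero) (allFin _)) (indicator-yes (c zero ≟ c zero) refl)))
              (colourClasses-drop c rest c₀∉)

  module _ {n} (c : Fin (suc n) → ℕ) (cols : List ℕ) where
    private
      c′ : Fin n → ℕ
      c′ x = c (suc x)

    rainbow-without-0 : ∀ s → Rainbow c cols (false ∷ᵥ s) → Rainbow c′ cols s
    rainbow-without-0 s (inj , col) =
      (λ u v u∈ v∈ u≢v → inj (suc u) (suc v) (there u∈) (there v∈) (λ eq → u≢v (Fin.suc-injective eq))) ,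
      (λ u u∈ → col (suc u) (there u∈))

    rainbow-without-0⁻ : ∀ s → Rainbow c′ cols s → Rainbow c cols (false ∷ᵥ s)
    rainbow-without-0⁻ s (inj , col) =
      (λ { (suc u) (suc v) (there u∈) (there v∈) u≢v → inj u v u∈ v∈ (λ eq → u≢v (cong suc eq)) }) ,
      (λ { (suc u) (there u∈) → col u u∈ })

    rainbow-with-0-∉ : c zero ∉ cols → ∀ s → ¬ Rainbow c cols (true ∷ᵥ s)
    rainbow-with-0-∉ c₀∉ s (_ , col) = c₀∉ (col zero here)

    module _ {rest} (perm : cols ↭ c zero ∷ rest) (c₀∉ : c zero ∉ rest) where

      rainbow-with-0 : ∀ s → Rainbow c cols (true ∷ᵥ s) → Rainbow c′ rest s
      rainbow-with-0 s (inj , col) =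
        (λ u v u∈ v∈ u≢v → inj (suc u) (suc v) (there u∈) (there v∈) (λ eq → u≢v (Fin.suc-injective eq))) ,
        (λ u u∈ → in-rest (∈-resp-↭ perm (col (suc u) (there u∈))) (inj (suc u) zero (there u∈) here λ ()))
        where
          in-rest : ∀ {x} → x ∈ c zero ∷ rest → x ≢ c zero → x ∈ rest
          in-rest (here x≡c₀) x≢c₀ = ⊥-elim (x≢c₀ x≡c₀)
          in-rest (there x∈)  _    = x∈

      rainbow-with-0⁻ : ∀ s → Rainbow c′ rest s → Rainbow c cols (true ∷ᵥ s)
      rainbow-with-0⁻ s (inj , col) = inj′ , col′
        where
          inj′ : ∀ u v → u ∈ₛ (true ∷ᵥ s) → v ∈ₛ (true ∷ᵥ s) → u ≢ v → c u ≢ c v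
          inj′ zero    zero    _          _          u≢v = ⊥-elim (u≢v refl)
          inj′ zero    (suc v) _          (there v∈) _   eq = c₀∉ (subst (_∈ rest) (sym eq) (col v v∈))
          inj′ (suc u) zero    (there u∈) _          _   eq = c₀∉ (subst (_∈ rest) eq (col u u∈))
          inj′ (suc u) (suc v) (there u∈) (there v∈) u≢v = inj u v u∈ v∈ (λ eq → u≢v (cong suc eq))
          col′ : ∀ u → u ∈ₛ (true ∷ᵥ s) → c u ∈ cols
          col′ zero    here       = ∈-resp-↭ (↭-sym perm) (here refl)
          col′ (suc u) (there u∈) = ∈-resp-↭ (↭-sym perm) (there (col u u∈))

  count-rainbow : ∀ n (c : Fin n → ℕ) {cols} → Unique cols → ∀ k →
    count (rainbowOfSize? c cols k) (allSubsets n) ≡ esym k (colourClasses c cols (allFin n))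
  count-rainbow zero c {cols} uniq zero with rainbowOfSize? c cols zero []ᵥ
  ... | yes _ = refl
  ... | no ¬rainbow = ⊥-elim (¬rainbow (refl , (λ _ _ ()) , λ _ ()))
  count-rainbow zero c {cols} uniq (suc k) with rainbowOfSize? c cols (suc k) []ᵥ
  ... | yes (() , _)
  ... | no _ = sym (esym-zeros k cols)
  count-rainbow (suc n) c {cols} uniq k = begin
      count (rainbowOfSize? c cols k) (allSubsets (suc n))
    ≡⟨ count-allSubsets (rainbowOfSize? c cols k) ⟩
      count (with-0 k) (allSubsets n) + count (λ s → rainbowOfSize? c cols k (false ∷ᵥ s)) (allSubsets n)
    ≡⟨ cong (count (with-0 k) (allSubsets n) +_) (trans
         (count-cong _ (rainbowOfSize? c′ cols k) (λ s (size , r) → size , rainbow-without-0 c cols s r)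
                     (λ s (size , r) → size , rainbow-without-0⁻ c cols s r) (allSubsets n))
         (count-rainbow n c′ uniq k)) ⟩
      count (with-0 k) (allSubsets n) + esym k (colourClasses c′ cols (allFin n))
    ≡⟨ through-0 (c zero ∈? cols) k ⟩
      esym k (colourClasses c cols (allFin (suc n))) ∎
    where
      open ≡-Reasoning
      c′ : Fin n → ℕ
      c′ x = c (suc x)
      with-0 : ∀ k (s : Subset n) → Dec (∣ true ∷ᵥ s ∣ ≡ k × Rainbow c cols (true ∷ᵥ s))
      with-0 k s = rainbowOfSize? c cols k (true ∷ᵥ s)

      through-0 : Dec (c zero ∈ cols) → ∀ k →
        count (with-0 k) (allSubsets n) + esym k (colourClasses c′ cols (allFin n))
          ≡ esym k (colourClasses c cols (allFin (suc n)))
      through-0 (no c₀∉) k = cong₂ _+_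
        (count-none (with-0 k) (λ s (_ , r) → rainbow-with-0-∉ c cols c₀∉ s r) (allSubsets n))
        (cong (esym k) (sym (colourClasses-drop c cols c₀∉)))
      through-0 (yes c₀∈) zero = cong (_+ 1) (count-none (with-0 zero) (λ _ (size , _) → 1+n≢0 size) (allSubsets n))
      through-0 (yes c₀∈) (suc k) with extract c₀∈
      ... | rest , perm with Unique-resp-↭ {cols} {c zero ∷ rest} (↭⇒↭ₛ perm) uniq
      ...   | c₀≢rest ∷ uniq-rest = begin
          count (with-0 (suc k)) (allSubsets n) + esym (suc k) (classes′ cols)
        ≡⟨ cong₂ _+_ (trans
             (count-cong _ (rainbowOfSize? c′ rest k) (λ s (size , r) → suc-injective size , rainbow-with-0 c cols perm c₀∉ s r)
                         (λ s (size , r) → cong suc size , rainbow-with-0⁻ c cols perm c₀∉ s r) (allSubsets n))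
             (count-rainbow n c′ uniq-rest k))
           (esym-↭ (map⁺ _ perm) (suc k)) ⟩
          esym k (classes′ rest) + esym (suc k) (a₀ ∷ classes′ rest)
        ≡⟨ +-comm (esym k (classes′ rest)) _ ⟩
          esym (suc k) (a₀ ∷ classes′ rest) + esym k (classes′ rest)
        ≡⟨ sym (esym-suc-head k a₀ (classes′ rest)) ⟩
          esym (suc k) (suc a₀ ∷ classes′ rest)
        ≡⟨ cong (esym (suc k)) (sym (colourClasses-front c rest c₀∉)) ⟩
          esym (suc k) (colourClasses c (c zero ∷ rest) (allFin (suc n)))
        ≡⟨ esym-↭ (map⁺ _ (↭-sym perm)) (suc k) ⟩
          esym (suc k) (colourClasses c cols (allFin (suc n))) ∎
        where
          classes′ : List ℕ → List ℕ
          classes′ cs = colourClasses c′ cs (allFin n)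
          a₀ = count (λ x → c′ x ≟ c zero) (allFin n)
          c₀∉ : c zero ∉ rest
          c₀∉ = All¬⇒¬Any c₀≢rest

module BannerFamilies where
  open import Defs using (allSubsets; pair)
  open import Data.Nat using (ℕ; zero; suc; _+_; _*_; _∸_; _≤_; z≤n; s≤s; _≟_)
  open import Data.Nat.Properties
  open import Data.Nat.ListAction using (sum)
  open import Data.Fin using (Fin; zero; suc)
  import Data.Fin.Properties as Fin
  open import Data.Fin.Subset using (Subset; ∣_∣; _∈_; _∉_; _⊆_; ⁅_⁆)
  open import Data.Fin.Subset.Properties using (_∈?_; x∈⁅x⁆)
  open import Data.Vec using (here; there) renaming ([] to []ᵥ)
  open import Data.List using (List; []; _∷_; length; map; filter; allFin)
  open import Data.List.Properties using (length-map)
  open import Data.List.Membership.Propositional.Properties using (∈-filter⁺; ∈-allFin)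
  open import Data.List.Relation.Unary.Any using (Any; here; there; any?) renaming (map to any-map)
  open import Data.List.Relation.Unary.All using (All; universal) renaming (lookup to all-lookup)
  import Data.List.Relation.Unary.All.Properties as All
  open import Data.List.Extrema.Nat using (argmax; f[xs]≤f[argmax])
  open import Data.Product using (_×_; _,_; proj₁; proj₂)
  open import Data.Sum using (inj₁; inj₂)
  open import Data.Empty using (⊥-elim)
  open import Relation.Nullary using (¬_; Dec; yes; no)
  open import Relation.Nullary.Decidable using (_×-dec_; _→-dec_; ¬?)
  open import Relation.Unary using (Decidable)
  open import Relation.Binary.PropositionalEquality using (_≡_; _≢_; refl; sym; trans; cong; cong₂; subst)

  open Counting
  open ElementarySymmetric using (esym; sum-bounded)
  open ResidueClasses using (classSizes; esym-split-part)
  open Subsets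

  -- A family of vertex sets of Fin n (given by a decidable predicate, supported on a decidable
  -- set of vertices) that behaves like the faces of a k-banner complex of dimension < D:
  -- it is closed under subsets, a face of size ≥ k extends by any vertex adjacent to all its
  -- elements, and faces of size ≥ k have at most D elements.
  record BannerFamily (n k D : ℕ) : Set₁ where
    field
      Face        : Subset n → Set
      face?       : Decidable Face
      Vertex      : Fin n → Set
      vertex?     : Decidable Vertex
      down-closed : ∀ {σ τ} → σ ⊆ τ → Face τ → Face σ
      extendable  : ∀ {σ w} → Face σ → k ≤ ∣ σ ∣ → w ∉ σ → Face ⁅ w ⁆ →
                    (∀ u → u ∈ σ → Face (pair u w)) → Face (ins w σ)
      bounded     : ∀ {σ} → Face σ → k ≤ ∣ σ ∣ → ∣ σ ∣ ≤ D
      supported   : ∀ {σ x} → Face σ → x ∈ σ → Vertex x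

    faces : ℕ → ℕ
    faces j = count (λ σ → (∣ σ ∣ ≟ j) ×-dec face? σ) (allSubsets n)

    vertices : ℕ
    vertices = count vertex? (allFin n)

  open BannerFamily public using (faces; vertices)

  degree : ∀ {n k D} → BannerFamily n k D → Fin n → ℕ
  degree {n} {k} F w = count (λ σ → ((∣ σ ∣ ≟ k) ×-dec BannerFamily.face? F σ) ×-dec (w ∈? σ)) (allSubsets n)

  -- The inductive step: the (k+1)-faces of a family of dimension ≤ D+1 are counted through a
  -- vertex v of maximal degree.  Faces meeting a non-neighbour w of v number at most
  -- deg w ≤ deg v = #(k-faces of the link of v); the other faces lie in the family induced on
  -- the neighbours of v.  Both of these have dimension ≤ D and are bounded inductively.
  module Step {n k D} (F : BannerFamily (suc n) (suc k) (suc D))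
              (IH : ∀ {j} (G : BannerFamily (suc n) j D) → faces G j ≤ esym j (classSizes D (vertices G)))
              (v : Fin (suc n)) (degree-max : ∀ w → degree F w ≤ degree F v) where
    open BannerFamily F hiding (faces; vertices)

    private
      K = suc k
      S = allSubsets (suc n)

    Kface? : Decidable (λ σ → ∣ σ ∣ ≡ K × Face σ)
    Kface? σ = (∣ σ ∣ ≟ K) ×-dec face? σ

    -- The neighbours of v; the other vertices (v among them) are listed in far.
    Neighbour : Fin (suc n) → Set
    Neighbour x = Vertex x × x ≢ v × Face (pair v x)

    neighbour? : Decidable Neighbour
    neighbour? x = vertex? x ×-dec (¬? (x Fin.≟ v) ×-dec face? (pair v x))

    far : List (Fin (suc n))
    far = filter (λ x → vertex? x ×-dec ¬? (neighbour? x)) (allFin (suc n))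

    link : BannerFamily (suc n) k D
    link = record
      { Face        = λ τ → v ∉ τ × Face (ins v τ)
      ; face?       = λ τ → ¬? (v ∈? τ) ×-dec face? (ins v τ)
      ; Vertex      = Neighbour
      ; vertex?     = neighbour?
      ; down-closed = λ σ⊆τ (v∉τ , τ+v) → (λ v∈σ → v∉τ (σ⊆τ v∈σ)) , down-closed (ins-mono v σ⊆τ) τ+v
      ; extendable  = extend
      ; bounded     = λ {σ} (v∉σ , σ+v) k≤ → ≤-pred (subst (_≤ suc D) (ins-size v σ v∉σ)
                        (bounded σ+v (≤-trans (s≤s k≤) (≤-reflexive (sym (ins-size v σ v∉σ))))))
      ; supported   = λ {σ} {x} (v∉σ , σ+v) x∈ →
                        supported σ+v (ins-⊇ v σ x∈) , (λ x≡v → v∉σ (subst (_∈ σ) x≡v x∈)) ,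
                        down-closed (pair-⊆ (ins-∈ v σ) (ins-⊇ v σ x∈)) σ+v
      }
      where
        extend : ∀ {σ w} → v ∉ σ × Face (ins v σ) → k ≤ ∣ σ ∣ → w ∉ σ → v ∉ ⁅ w ⁆ × Face (ins v ⁅ w ⁆) →
                 (∀ u → u ∈ σ → v ∉ pair u w × Face (ins v (pair u w))) → v ∉ ins w σ × Face (ins v (ins w σ))
        extend {σ} {w} (v∉σ , σ+v) k≤ w∉σ (v∉w , w+v) edges = v∉σ+w , down-closed (ins-comm v w σ) σ+v+w
          where
            v≢w : v ≢ w
            v≢w v≡w = v∉w (subst (λ z → v ∈ ⁅ z ⁆) v≡w (x∈⁅x⁆ v))
            v∉σ+w : v ∉ ins w σ
            v∉σ+w v∈ with ins-⁻ w σ v∈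
            ... | inj₁ v≡w = v≢w v≡w
            ... | inj₂ v∈σ = v∉σ v∈σ
            w∉σ+v : w ∉ ins v σ
            w∉σ+v w∈ with ins-⁻ v σ w∈
            ... | inj₁ w≡v = v≢w (sym w≡v)
            ... | inj₂ w∈σ = w∉σ w∈σ
            edges′ : ∀ u → u ∈ ins v σ → Face (pair u w)
            edges′ u u∈ with ins-⁻ v σ u∈
            ... | inj₁ refl = down-closed (pair-⊆ (ins-∈ v ⁅ w ⁆) (ins-⊇ v ⁅ w ⁆ (x∈⁅x⁆ w))) w+v
            ... | inj₂ u∈σ  = down-closed (ins-⊇ v (pair u w)) (proj₂ (edges u u∈σ))
            σ+v+w : Face (ins w (ins v σ))
            σ+v+w = extendable σ+v (≤-trans (s≤s k≤) (≤-reflexive (sym (ins-size v σ v∉σ)))) w∉σ+v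
                      (down-closed (ins-⊇ v ⁅ w ⁆) w+v) edges′

    -- The family induced on the neighbours of v.  Its faces of size ≥ K extend by v,
    -- so it has dimension ≤ D.
    induced : BannerFamily (suc n) K D
    induced = record
      { Face        = λ σ → Face σ × (∀ x → x ∈ σ → Neighbour x)
      ; face?       = λ σ → face? σ ×-dec Fin.all? (λ x → (x ∈? σ) →-dec neighbour? x)
      ; Vertex      = Neighbour
      ; vertex?     = neighbour?
      ; down-closed = λ σ⊆τ (τ-face , τ-nb) → down-closed σ⊆τ τ-face , (λ x x∈ → τ-nb x (σ⊆τ x∈))
      ; extendable  = λ {σ} {w} (σ-face , σ-nb) K≤ w∉σ (w-face , w-nb) edges →
                        extendable σ-face K≤ w∉σ w-face (λ u u∈ → proj₁ (edges u u∈)) ,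
                        (λ x x∈ → [ (λ { refl → w-nb x (x∈⁅x⁆ x) }) , σ-nb x ]′ (ins-⁻ w σ x∈))
      ; bounded     = dimension
      ; supported   = λ (_ , σ-nb) x∈ → σ-nb _ x∈
      }
      where
        open import Data.Sum using ([_,_]′)
        dimension : ∀ {σ} → Face σ × (∀ x → x ∈ σ → Neighbour x) → K ≤ ∣ σ ∣ → ∣ σ ∣ ≤ D
        dimension {σ} (σ-face , σ-nb) K≤ = ≤-pred (subst (_≤ suc D) (ins-size v σ v∉σ)
            (bounded σ+v (≤-trans K≤ (≤-trans (n≤1+n _) (≤-reflexive (sym (ins-size v σ v∉σ)))))))
          where
            v∉σ : v ∉ σ
            v∉σ v∈ = proj₁ (proj₂ (σ-nb v v∈)) refl
            x = proj₁ (member σ K≤)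
            edge : ∀ {u} → u ∈ σ → Face (pair u v)
            edge u∈ = down-closed (pair-sym _ v) (proj₂ (proj₂ (σ-nb _ u∈)))
            σ+v : Face (ins v σ)
            σ+v = extendable σ-face K≤ v∉σ
                    (down-closed (singleton-⊆-pair v x) (proj₂ (proj₂ (σ-nb x (proj₂ (member σ K≤))))))
                    (λ u u∈ → edge u∈)

    degree-link : degree F v ≡ faces link k
    degree-link = trans (count-containing v Kface?) (count-cong _ _ to from S)
      where
        to : ∀ τ → v ∉ τ × (∣ ins v τ ∣ ≡ K × Face (ins v τ)) → ∣ τ ∣ ≡ k × v ∉ τ × Face (ins v τ)
        to τ (v∉τ , size , face) = suc-injective (trans (sym (ins-size v τ v∉τ)) size) , v∉τ , face
        from : ∀ τ → ∣ τ ∣ ≡ k × v ∉ τ × Face (ins v τ) → v ∉ τ × (∣ ins v τ ∣ ≡ K × Face (ins v τ))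
        from τ (size , v∉τ , face) = v∉τ , trans (ins-size v τ v∉τ) (cong suc size) , face

    vertices-split : vertices F ≡ vertices link + length far
    vertices-split = trans (count-split vertex? neighbour? (allFin (suc n)))
      (cong (_+ length far) (count-cong (λ x → vertex? x ×-dec neighbour? x) neighbour? (λ _ (_ , nb) → nb) (λ _ nb → proj₁ nb , nb) (allFin (suc n))))

    meets-far? : ∀ σ → Dec (Any (_∈ σ) far)
    meets-far? σ = any? (_∈? σ) far

    faces-meeting : ∀ ws → count (λ σ → Kface? σ ×-dec any? (_∈? σ) ws) S ≤ sum (map (degree F) ws)
    faces-meeting []       = ≤-reflexive (count-none _ (λ { _ (_ , ()) }) S)
    faces-meeting (w ∷ ws) =
      ≤-trans (count-union (λ σ → Kface? σ ×-dec (w ∈? σ)) (λ σ → Kface? σ ×-dec any? (_∈? σ) ws) _ split S)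
              (+-monoʳ-≤ (degree F w) (faces-meeting ws))
      where
        split : ∀ σ → _ × Any (_∈ σ) (w ∷ ws) → _
        split σ (face , here w∈)    = inj₁ (face , w∈)
        split σ (face , there any∈) = inj₂ (face , any∈)

    faces-meeting-far : count (λ σ → Kface? σ ×-dec meets-far? σ) S ≤ length far * degree F v
    faces-meeting-far = begin
      count (λ σ → Kface? σ ×-dec meets-far? σ) S  ≤⟨ faces-meeting far ⟩
      sum (map (degree F) far)                      ≤⟨ sum-bounded (All.map⁺ (universal degree-max far)) ⟩
      length (map (degree F) far) * degree F v      ≡⟨ cong (_* degree F v) (length-map (degree F) far) ⟩
      length far * degree F v                       ∎
      where open ≤-Reasoning

    faces-avoiding-far : count (λ σ → Kface? σ ×-dec ¬? (meets-far? σ)) S ≤ faces induced K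
    faces-avoiding-far = count-mono _ _ (λ σ ((size , face) , avoids) → size , face , near face avoids) S
      where
        near : ∀ {σ} → Face σ → ¬ Any (_∈ σ) far → ∀ x → x ∈ σ → Neighbour x
        near face avoids x x∈ with neighbour? x
        ... | yes nb = nb
        ... | no ¬nb = ⊥-elim (avoids (any-map (λ { refl → x∈ })
                         (∈-filter⁺ (λ y → vertex? y ×-dec ¬? (neighbour? y)) (∈-allFin x) (supported face x∈ , ¬nb))))

    bound : faces F K ≤ esym K (classSizes (suc D) (vertices F))
    bound = begin
        faces F K
      ≡⟨ count-split Kface? meets-far? S ⟩
        count (λ σ → Kface? σ ×-dec meets-far? σ) S + count (λ σ → Kface? σ ×-dec ¬? (meets-far? σ)) S
      ≤⟨ +-mono-≤ faces-meeting-far faces-avoiding-far ⟩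
        length far * degree F v + faces induced K
      ≡⟨ cong₂ (λ a b → a * b + faces induced K) far-count degree-link ⟩
        (u ∸ m) * faces link k + faces induced K
      ≤⟨ +-mono-≤ (*-monoʳ-≤ (u ∸ m) (IH link)) (IH induced) ⟩
        (u ∸ m) * esym k (classSizes D m) + esym K (classSizes D m)
      ≤⟨ esym-split-part K D m≤u ⟩
        esym K (classSizes (suc D) u)
      ∎
      where
        open ≤-Reasoning
        u = vertices F
        m = vertices link
        m≤u : m ≤ u
        m≤u = ≤-trans (m≤m+n m (length far)) (≤-reflexive (sym vertices-split))
        far-count : length far ≡ u ∸ m
        far-count = sym (trans (cong (_∸ m) vertices-split) (m+n∸m≡n m (length far)))

  face-bound : ∀ D {n k} (F : BannerFamily n k D) → faces F k ≤ esym k (classSizes D (vertices F))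
  face-bound D {n} {zero} F =
    ≤-trans (count-mono _ (λ σ → ∣ σ ∣ ≟ 0) (λ _ (size , _) → size) (allSubsets n)) (≤-reflexive (count-size-zero n))
  face-bound zero {n} {suc k} F = ≤-reflexive (count-none _ too-large (allSubsets n))
    where
      too-large : ∀ σ → ¬ (∣ σ ∣ ≡ suc k × BannerFamily.Face F σ)
      too-large σ (size , face) = n≮0 (subst (_≤ 0) size (BannerFamily.bounded F face (≤-reflexive (sym size))))
  face-bound (suc D) {zero} {suc k} F =
    ≤-trans (≤-reflexive (count-none (λ σ → (∣ σ ∣ ≟ suc k) ×-dec BannerFamily.face? F σ) (λ { []ᵥ (() , _) }) (allSubsets zero))) z≤n
  face-bound (suc D) {suc n} {suc k} F =
    Step.bound F (face-bound D) v (λ w → all-lookup (f[xs]≤f[argmax] {f = degree F} zero (allFin (suc n))) (∈-allFin w))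
    where
      v = argmax (degree F) zero (allFin (suc n))

open import Defs
open import Data.Nat using (ℕ; _≤_; NonZero)

open import Data.Bool using (T?)
open import Data.Nat using (zero; suc; s≤s; _%_; _≟_)
open import Data.Nat.Properties using (≤-trans; ≤-reflexive; n≮0; module ≤-Reasoning)
open import Data.Nat.DivMod using (m%n<n)
open import Data.Fin using (Fin; toℕ)
open import Data.Fin.Subset using (∣_∣; _∈_; _∉_)
open import Data.List using (_∷_; allFin; upTo; applyUpTo; tabulate; map)
open import Data.List.Properties using (length-tabulate; map-tabulate; map-cong)
open import Data.List.Membership.Propositional.Properties using (∈-upTo⁺)
open import Data.List.Relation.Unary.Unique.Propositional.Properties using (upTo⁺)
open import Data.Product using (_,_; proj₂)
open import Data.Sum using (inj₁; inj₂)
open import Data.Unit using (⊤; tt)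
open import Data.Empty using (⊥-elim)
open import Relation.Nullary using (yes)
open import Relation.Binary.PropositionalEquality using (_≡_; refl; sym; trans; cong; module ≡-Reasoning)

open Counting
open ElementarySymmetric using (esym)
open ResidueClasses using (colourClasses; classSizes)
open Subsets
open RainbowSets using (Rainbow; rainbowOfSize?; count-rainbow)
open BannerFamilies using (BannerFamily; faces; vertices; face-bound)

tabulate-toℕ : ∀ n {A : Set} (f : ℕ → A) → tabulate (λ (x : Fin n) → f (toℕ x)) ≡ applyUpTo f n
tabulate-toℕ zero    f = refl
tabulate-toℕ (suc n) f = cong (f 0 ∷_) (tabulate-toℕ n (λ x → f (suc x)))

-- The cliques of Γ(n, D+1) are the rainbow sets of the colouring x ↦ x mod (D+1), so the
-- number of i-cliques is the i-th elementary symmetric polynomial of its part sizes.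
binomΓ≡esym : ∀ n D i → binomΓ n i (suc D) ≡ esym i (classSizes (suc D) n)
binomΓ≡esym n D i = begin
    binomΓ n i (suc D)
  ≡⟨ count-cong _ (rainbowOfSize? colour colours i) (λ τ (size , clique) → size , to τ clique)
                  (λ τ (size , rainbow) → size , from τ rainbow) (allSubsets n) ⟩
    count (rainbowOfSize? colour colours i) (allSubsets n)
  ≡⟨ count-rainbow n colour (upTo⁺ (suc D)) i ⟩
    esym i (colourClasses colour colours (allFin n))
  ≡⟨ cong (esym i) (map-cong (λ r → trans (sym (count-map (λ y → y % suc D ≟ r) toℕ (allFin n)))
                                           (cong (count (λ y → y % suc D ≟ r)) toℕ-allFin)) colours) ⟩
    esym i (classSizes (suc D) n)
  ∎
  where
    open ≡-Reasoning
    colour : Fin n → ℕ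
    colour x = toℕ x % suc D
    colours = upTo (suc D)
    toℕ-allFin : map toℕ (allFin n) ≡ upTo n
    toℕ-allFin = trans (map-tabulate (λ x → x) toℕ) (tabulate-toℕ n (λ x → x))
    to : ∀ τ → IsΓClique (suc D) τ → Rainbow colour colours τ
    to τ clique = (λ u v u∈ v∈ u≢v → proj₂ (clique u v u∈ v∈ u≢v)) , λ u _ → ∈-upTo⁺ (m%n<n (toℕ u) (suc D))
    from : ∀ τ → Rainbow colour colours τ → IsΓClique (suc D) τ
    from τ (injective , _) u v u∈ v∈ u≢v = u≢v , injective u v u∈ v∈ u≢v

-- The banner condition lets a face σ with |σ| ≥ i be extended by any vertex w adjacent to all
-- of σ: σ ∪ {w} is a clique, and it is critical since removing w leaves the face σ.
banner-extends : ∀ {n i} (Δ : SimplicialComplex n) → IsBanner i Δ →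
                 ∀ {σ w} → Face Δ σ → i ≤ ∣ σ ∣ → w ∉ σ →
                 (∀ u → u ∈ σ → Face Δ (pair u w)) → Face Δ (ins w σ)
banner-extends Δ banner {σ} {w} σ-face i≤ w∉σ edges =
  banner (ins w σ) clique (w , ins-∈ w σ , downClosed Δ _ _ (ins-remove w σ) σ-face)
         (≤-trans (s≤s i≤) (≤-reflexive (sym (ins-size w σ w∉σ))))
  where
    clique : IsClique Δ (ins w σ)
    clique u v u∈ v∈ u≢v with ins-⁻ w σ u∈ | ins-⁻ w σ v∈
    ... | inj₁ refl | inj₁ refl = ⊥-elim (u≢v refl)
    ... | inj₁ refl | inj₂ v∈σ  = downClosed Δ _ _ (pair-sym u v) (edges v v∈σ)
    ... | inj₂ u∈σ  | inj₁ refl = edges u u∈σ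
    ... | inj₂ u∈σ  | inj₂ v∈σ  = downClosed Δ _ _ (pair-⊆ u∈σ v∈σ) σ-face

complex-family : ∀ {n d i} (Δ : SimplicialComplex n) → HasDimensionMinusOne Δ d → IsBanner i Δ →
                 BannerFamily n i d
complex-family Δ dimension banner = record
  { Face        = Face Δ
  ; face?       = λ σ → T? (isFace Δ σ)
  ; Vertex      = λ _ → ⊤
  ; vertex?     = λ _ → yes tt
  ; down-closed = downClosed Δ _ _
  ; extendable  = λ σ-face i≤ w∉σ _ edges → banner-extends Δ banner σ-face i≤ w∉σ edges
  ; bounded     = λ σ-face _ → proj₂ dimension _ σ-face
  ; supported   = λ _ _ → tt
  }

lemma7p4 : ∀ (n d i : ℕ) .{{_ : NonZero d}} (Δ : SimplicialComplex n) →
           1 ≤ i → i ≤ d →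
           HasDimensionMinusOne Δ d → IsBanner i Δ →
           fsize Δ i ≤ binomΓ n i d
lemma7p4 n zero    i Δ 1≤i i≤d dimension banner = ⊥-elim (n≮0 (≤-trans 1≤i i≤d))
lemma7p4 n (suc D) i Δ 1≤i i≤d dimension banner = begin
    fsize Δ i                                        ≡⟨⟩
    faces F i                                        ≤⟨ face-bound (suc D) F ⟩
    esym i (classSizes (suc D) (vertices F))         ≡⟨ cong (λ u → esym i (classSizes (suc D) u)) all-vertices ⟩
    esym i (classSizes (suc D) n)                    ≡⟨ sym (binomΓ≡esym n D i) ⟩
    binomΓ n i (suc D)                               ∎
  where
    open ≤-Reasoning
    F = complex-family Δ dimension banner
    all-vertices : vertices F ≡ n
    all-vertices = trans (count-all (λ _ → yes tt) (λ _ → tt) (allFin n)) (length-tabulate (λ x → x))
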